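{- Every (finite) oriented graph missing a generalized comb has a vertex $v$ with $d^+(v)\le d^{++}(v)$ (i.e. satisfies the Second Neighborhood Conjecture).
   Context: An oriented graph is a digraph with no loops, no parallel arcs and no directed 2-cycles. $N^+(v)$ is the out-neighbourhood of $v$, $N^{++}(v)=\{x\notin N^+(v): \exists y\in N^+(v), (y,x)\in E(D)\}$, $d^+(v)=|N^+(v)|$, $d^{++}(v)=|N^{++}(v)|$. A missing edge is a pair of distinct vertices joined by no arc; the missing graph of $D$ has as edges the missing edges and as vertices the vertices incident to a missing edge; $D$ is missing $G$ if its missing graph is $G$. For vertex sets $U,W$, $E[U,W]$ is the set of edges between them. A split graph (stable set plus clique) is complete split if all stable–clique pairs are edges, perfect split if the stable–clique edges form a perfect matching. A generalized comb is a graph $G$ with: (1) $V(G)$ the disjoint union of $A_0,\dots,A_n,M_1,\dots,M_l,X_1,\dots,X_{n+1},Y_2,\dots,Y_{l+2}$, $Y_1:=X_1$; (2) $A\cup M$ stable, $A=\bigcup_{i=0}^nA_i$, $M=\bigcup_{i=1}^lM_i$; (3) $X\cup Y$ a clique, $X=\bigcup_{i=1}^{n+1}X_i$, $Y=\bigcup_{i=1}^{l+2}Y_i$; (4) for $1\le j\le i\le n$, $G[A_i\cup X_j]$ complete split; (5) $G[A\cup Y]$ complete split; (6) for $1\le i\le l$, $G[Y_i\cup M_i]$ perfect split or $M_i=\emptyset$; (7) for $1\le i<j\le l+1$, $G[Y_j\cup M_i]$ complete split; (8) $X_{n+1},Y_{l+2},Y_{l+1},A_0$ are the only possibly empty sets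 among the $X_i,Y_i,A_i$; (9) no other edges. -}

module Defs where

open import Data.Nat using (ℕ; zero; suc; _+_; _≤_; _<_)
open import Data.Fin using (Fin; zero; suc)
open import Data.Bool using (Bool; true; false; _∧_; _∨_; not; if_then_else_)
open import Data.Product using (Σ; ∃; _×_; _,_)
open import Data.Sum using (_⊎_)
open import Data.Empty using (⊥)
open import Relation.Nullary using (¬_)
open import Relation.Binary.PropositionalEquality using (_≡_; _≢_)

Digraph : ℕ → Set
Digraph N = Fin N → Fin N → Bool

Arc : ∀ {N} → Digraph N → Fin N → Fin N → Set
Arc D u v = D u v ≡ true

-- Oriented graph: no loops, no directed 2-cycles (parallel arcs are
-- impossible for a relation).
IsOriented : ∀ {N} → Digraph N → Set
IsOriented {N} D = (∀ v → ¬ Arc D v v) × (∀ u v → Arc D u v → ¬ Arc D v u)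

countFin : ∀ {N} → (Fin N → Bool) → ℕ
countFin {zero} p = 0
countFin {suc N} p = (if p zero then 1 else 0) + countFin (λ i → p (suc i))

anyFin : ∀ {N} → (Fin N → Bool) → Bool
anyFin {zero} p = false
anyFin {suc N} p = p zero ∨ anyFin (λ i → p (suc i))

inN⁺⁺ : ∀ {N} → Digraph N → Fin N → Fin N → Bool
inN⁺⁺ D v x = not (D v x) ∧ anyFin (λ y → D v y ∧ D y x)

outdeg : ∀ {N} → Digraph N → Fin N → ℕ
outdeg D v = countFin (D v)

secondOutdeg : ∀ {N} → Digraph N → Fin N → ℕ
secondOutdeg D v = countFin (inN⁺⁺ D v)

Missing : ∀ {N} → Digraph N → Fin N → Fin N → Set
Missing D u v = (u ≢ v) × (D u v ≡ false) × (D v u ≡ false)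

record SubGraph (N : ℕ) : Set₁ where
  field
    Vtx : Fin N → Set
    Adj : Fin N → Fin N → Set

missingGraph : ∀ {N} → Digraph N → SubGraph N
missingGraph D = record
  { Vtx = λ v → ∃ λ u → Missing D u v
  ; Adj = Missing D }

-- Generalized combs.
-- Labels for the parts:  A i (0 ≤ i ≤ n), M i (1 ≤ i ≤ l),
-- X i (1 ≤ i ≤ n+1), Y i (2 ≤ i ≤ l+2); Y₁ := X₁.

data Label : Set where
  A M X Y : ℕ → Label

ValidLabel : ℕ → ℕ → Label → Set
ValidLabel n l (A i) = i ≤ n
ValidLabel n l (M i) = 1 ≤ i × i ≤ l
ValidLabel n l (X i) = 1 ≤ i × i ≤ n + 1
ValidLabel n l (Y i) = 2 ≤ i × i ≤ l + 2

InA : ℕ → Label → Set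
InA i (A j) = i ≡ j
InA i _ = ⊥

InM : ℕ → Label → Set
InM i (M j) = i ≡ j
InM i _ = ⊥

InX : ℕ → Label → Set
InX i (X j) = i ≡ j
InX i _ = ⊥

InY : ℕ → Label → Set
InY 1 (X j) = 1 ≡ j
InY i (Y j) = i ≡ j
InY i _ = ⊥

InAny : (ℕ → Label → Set) → Label → Set
InAny P a = ∃ λ i → P i a

InAM : Label → Set
InAM a = InAny InA a ⊎ InAny InM a

InXY : Label → Set
InXY a = InAny InX a ⊎ InAny InY a

-- Unordered "reason" an edge is allowed (conditions (3)-(7)).
EdgeReason : ℕ → Label → Label → Set
EdgeReason l a b =
    (InXY a × InXY b)
  ⊎ (∃ λ i → ∃ λ j → 1 ≤ j × j ≤ i × InA i a × InX j b)
  ⊎ (InAny InA a × InAny InY b)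
  ⊎ (∃ λ i → 1 ≤ i × i ≤ l × InM i a × InY i b)
  ⊎ (∃ λ i → ∃ λ j → i < j × j ≤ l + 1 × InM i a × InY j b)

record IsGeneralizedComb {N : ℕ} (G : SubGraph N) : Set where
  open SubGraph G
  field
    n l : ℕ
    lab : Fin N → Label
    -- (1) every vertex lies in exactly one of the (validly indexed) parts
    valid : ∀ v → Vtx v → ValidLabel n l (lab v)
    stableAM : ∀ u v → Vtx u → Vtx v → InAM (lab u) → InAM (lab v) → ¬ Adj u v
    cliqueXY : ∀ u v → Vtx u → Vtx v → u ≢ v → InXY (lab u) → InXY (lab v) → Adj u v
    compAX : ∀ i j u v → Vtx u → Vtx v → 1 ≤ j → j ≤ i → i ≤ n →
             InA i (lab u) → InX j (lab v) → Adj u v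
    compAY : ∀ u v → Vtx u → Vtx v → InAny InA (lab u) → InAny InY (lab v) → Adj u v
    matchM : ∀ i → 1 ≤ i → i ≤ l → (∃ λ w → Vtx w × InM i (lab w)) →
             (∀ m → Vtx m → InM i (lab m) →
                ∃ λ y → (Vtx y × InY i (lab y) × Adj m y) ×
                  (∀ y' → Vtx y' → InY i (lab y') → Adj m y' → y' ≡ y))
           × (∀ y → Vtx y → InY i (lab y) →
                ∃ λ m → (Vtx m × InM i (lab m) × Adj y m) ×
                  (∀ m' → Vtx m' → InM i (lab m') → Adj y m' → m' ≡ m))
    compMY : ∀ i j u v → Vtx u → Vtx v → 1 ≤ i → i < j → j ≤ l + 1 →
             InM i (lab u) → InY j (lab v) → Adj u v
    -- (8) non-emptiness: only X_{n+1}, Y_{l+2}, Y_{l+1}, A_0 may be empty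
    nonemptyA : ∀ i → 1 ≤ i → i ≤ n → ∃ λ v → Vtx v × InA i (lab v)
    nonemptyX : ∀ i → 1 ≤ i → i ≤ n → ¬ (i ≡ 1 × l ≡ 0) →
                ∃ λ v → Vtx v × InX i (lab v)
    nonemptyY : ∀ i → 2 ≤ i → i ≤ l → ∃ λ v → Vtx v × InY i (lab v)
    noOther : ∀ u v → Vtx u → Vtx v → Adj u v →
              EdgeReason l (lab u) (lab v) ⊎ EdgeReason l (lab v) (lab u)

MissingGeneralizedComb : ∀ {N} → Digraph N → Set
MissingGeneralizedComb D = IsGeneralizedComb (missingGraph D)

-- Say that a beats b if a → b, or b ↛ a and every in-neighbour of a reaches b in at most two
-- steps.  If neither of x, b beats the other, an in-neighbour v of x with no path of length ≤ 2
-- to b and an in-neighbour w of b with none to x make {xb, wv} an induced 2K₂ of the missing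
-- graph; in a generalized comb every induced 2K₂ consists of edges of the perfect matchings
-- between the M_i and Y_i, so each vertex is left unresolved by beats with at most one other.
--
-- The rest is the median-order argument of Havet and Thomassé.  Order the vertices with a feed
-- vertex d last, maximising first the number of forward beats-pairs and then the number of
-- pairs (non-out-neighbour of d, out-neighbour of d) in that order, and cut the order at the
-- vertices x outside N⁺(d) ∪ N⁺⁺(d).  No out-neighbour of d beats such an x, so on the segment
-- S before x every out-neighbour of d is beaten by x or is the one vertex unresolved with x.
-- If S had more first than second out-neighbours of d, moving x in front of S would increase
-- the potential: either more beats-pairs become forward, or their number is unchanged and the
-- unresolved out-neighbour increases the second count.  The final segment is handled likewise
-- by moving d in front of it.  Hence d⁺(d) ≤ d⁺⁺(d) for the feed vertex of a maximal order.

module Submission where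

open import Defs
open import Data.Bool using (Bool; true; false; _∧_; _∨_; not; if_then_else_)
open import Data.Bool.Properties using (¬-not; ∧-zeroʳ)
open import Data.Empty using (⊥; ⊥-elim)
open import Data.Fin using (Fin; zero; suc)
import Data.Fin.Properties as Fin
open import Data.List using (List; []; _∷_; _++_; [_]; _∷ʳ_; length; tabulate; allFin; initLast; _∷ʳ′_)
open import Data.List.Properties using (++-assoc; ++-identityʳ; length-++; length-tabulate)
open import Data.List.Relation.Unary.All as All using (All; []; _∷_)
open import Data.List.Relation.Unary.All.Properties using (∷ʳ⁺)
open import Data.List.Relation.Binary.Permutation.Propositional as ↭ using (_↭_; ↭-sym; ↭-trans)
open import Data.List.Relation.Binary.Permutation.Propositional.Properties
  using (shift; ++⁺ˡ; ++⁺ʳ; ↭-length; ∷↭∷ʳ)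
open import Data.Nat using (ℕ; zero; suc; _+_; _*_; _∸_; _≤_; _<_; z≤n; s≤s; _≤?_; _<?_; _≟_)
open import Data.Nat.Properties
open import Data.Nat.Tactic.RingSolver using (solve-∀)
open import Data.Product using (Σ; ∃; _×_; _,_; proj₁; proj₂)
open import Data.Sum using (_⊎_; inj₁; inj₂)
open import Relation.Nullary using (¬_; yes; no)
open import Relation.Binary.PropositionalEquality hiding ([_])

ι : Bool → ℕ
ι b = if b then 1 else 0

ι≤1 : ∀ b → ι b ≤ 1
ι≤1 true = ≤-refl
ι≤1 false = z≤n

ι-excluded-middle : ∀ b → 1 ≤ ι b + ι (not b)
ι-excluded-middle true = ≤-refl
ι-excluded-middle false = ≤-refl

∧-intro : ∀ {x y} → x ≡ true → y ≡ true → x ∧ y ≡ true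
∧-intro refl refl = refl

∧-elim : ∀ {x y} → x ∧ y ≡ true → x ≡ true × y ≡ true
∧-elim {true} {true} refl = refl , refl

∨-elim-false : ∀ {x y} → x ∨ y ≡ false → x ≡ false × y ≡ false
∨-elim-false {false} {false} refl = refl , refl

not-true : ∀ {x} → not x ≡ true → x ≡ false
not-true {false} refl = refl

not-false : ∀ {x} → not x ≡ false → x ≡ true
not-false {true} refl = refl

true≢false : ∀ {x} → x ≡ true → x ≢ false
true≢false refl ()

lex-< : ∀ K {a b} Q Q' → Q < K → a < b → K * a + Q < K * b + Q'
lex-< K {a} {b} Q Q' Q<K a<b = begin-strict
  K * a + Q    <⟨ +-monoʳ-< (K * a) Q<K ⟩
  K * a + K    ≡⟨ +-comm (K * a) K ⟩
  K + K * a    ≡⟨ *-suc K a ⟨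
  K * suc a    ≤⟨ *-monoʳ-≤ K a<b ⟩
  K * b        ≤⟨ m≤m+n (K * b) Q' ⟩
  K * b + Q'   ∎
  where open ≤-Reasoning

balance-< : ∀ {old new i o} → new + i ≡ old + o → i < o → old < new
balance-< {old} {new} {i} {o} e i<o = +-cancelʳ-< i old new (begin-strict
  old + i   <⟨ +-monoʳ-< old i<o ⟩
  old + o   ≡⟨ e ⟨
  new + i   ∎)
  where open ≤-Reasoning

balance-gain : ∀ {old new i o} c → new + i ≡ old + o → i < o + c → c ≤ 1 →
               old < new ⊎ (old ≡ new × c ≡ 1)
balance-gain {old} {new} {i} {o} c e i<o+c c≤1 with i <? o
... | yes i<o = inj₁ (balance-< e i<o)
... | no i≮o = inj₂ (+-cancelʳ-≡ i old new (trans (cong (old +_) i≡o) (sym e)) , c≡1 c i<o+c c≤1)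
  where
  i≡o : i ≡ o
  i≡o = ≤-antisym (≤-pred (subst (suc i ≤_) (+-comm o 1) (≤-trans i<o+c (+-monoʳ-≤ o c≤1))))
                  (≮⇒≥ i≮o)
  c≡1 : ∀ c → i < o + c → c ≤ 1 → c ≡ 1
  c≡1 zero i<o+0 _ = ⊥-elim (i≮o (subst (i <_) (+-identityʳ o) i<o+0))
  c≡1 (suc zero) _ _ = refl
  c≡1 (suc (suc _)) _ (s≤s ())

module _ {A : Set} where

  count : (A → Bool) → List A → ℕ
  count p [] = 0
  count p (x ∷ xs) = ι (p x) + count p xs

  count-++ : ∀ p xs ys → count p (xs ++ ys) ≡ count p xs + count p ys
  count-++ p [] ys = refl
  count-++ p (x ∷ xs) ys = trans (cong (ι (p x) +_) (count-++ p xs ys)) (sym (+-assoc (ι (p x)) _ _))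

  count-↭ : ∀ p {xs ys} → xs ↭ ys → count p xs ≡ count p ys
  count-↭ p ↭.refl = refl
  count-↭ p (↭.prep x π) = cong (ι (p x) +_) (count-↭ p π)
  count-↭ p (↭.swap x y π) =
    trans (cong (λ k → ι (p x) + (ι (p y) + k)) (count-↭ p π)) (+-left-swap (ι (p x)) (ι (p y)) _)
    where
    +-left-swap : ∀ a b c → a + (b + c) ≡ b + (a + c)
    +-left-swap = solve-∀
  count-↭ p (↭.trans π ρ) = trans (count-↭ p π) (count-↭ p ρ)

  count-false : ∀ {p} xs → (∀ x → p x ≡ false) → count p xs ≡ 0
  count-false [] _ = refl
  count-false {p} (x ∷ xs) h rewrite h x = count-false xs h

  count≤length : ∀ p xs → count p xs ≤ length xs
  count≤length p [] = z≤n
  count≤length p (x ∷ xs) = +-mono-≤ (ι≤1 (p x)) (count≤length p xs)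

  count-infix : ∀ p pre S rest → count p S ≤ count p (pre ++ S ++ rest)
  count-infix p pre S rest = begin
    count p S                            ≤⟨ m≤m+n _ _ ⟩
    count p S + count p rest             ≡⟨ count-++ p S rest ⟨
    count p (S ++ rest)                  ≤⟨ m≤n+m _ _ ⟩
    count p pre + count p (S ++ rest)    ≡⟨ count-++ p pre (S ++ rest) ⟨
    count p (pre ++ S ++ rest)           ∎
    where open ≤-Reasoning

  count-mono : ∀ {p q} {xs} → All (λ x → p x ≡ true → q x ≡ true) xs → count p xs ≤ count q xs
  count-mono [] = z≤n
  count-mono {p} {q} {x ∷ xs} (h ∷ hs) = +-mono-≤ (ι-mono (p x) (q x) h) (count-mono hs)
    where
    ι-mono : ∀ a b → (a ≡ true → b ≡ true) → ι a ≤ ι b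
    ι-mono true b h rewrite h refl = ≤-refl
    ι-mono false b h = z≤n

  count-≤-+ : ∀ {p q r} → (∀ x → ι (p x) ≤ ι (q x) + ι (r x)) →
              ∀ xs → count p xs ≤ count q xs + count r xs
  count-≤-+ h [] = z≤n
  count-≤-+ {p} {q} {r} h (x ∷ xs) =
    ≤-trans (+-mono-≤ (h x) (count-≤-+ h xs)) (≤-reflexive (+-interchange (ι (q x)) (ι (r x)) _ _))
    where
    +-interchange : ∀ a b c d → (a + b) + (c + d) ≡ (a + c) + (b + d)
    +-interchange = solve-∀

  forward : (A → A → Bool) → List A → ℕ
  forward R [] = 0
  forward R (x ∷ xs) = count (R x) xs + forward R xs

  forward≤length² : ∀ R xs → forward R xs ≤ length xs * length xs
  forward≤length² R [] = z≤n
  forward≤length² R (x ∷ xs) =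
    ≤-trans (+-mono-≤ (count≤length (R x) xs) (forward≤length² R xs)) (square-suc (length xs))
    where
    square-suc : ∀ n → n + n * n ≤ suc n * suc n
    square-suc n = ≤-trans (m≤n+m _ (suc n)) (≤-reflexive (expand n))
      where
      expand : ∀ n → suc n + (n + n * n) ≡ suc n * suc n
      expand = solve-∀

  forward-moveˡ : ∀ R x S rest →
    forward R (x ∷ S ++ rest) + count (λ u → R u x) S
      ≡ forward R (S ++ x ∷ rest) + count (R x) S
  forward-moveˡ R x [] rest = refl
  forward-moveˡ R x (s ∷ S) rest = begin
      (ι (R x s) + count (R x) (S ++ rest)) + (count (R s) (S ++ rest) + forward R (S ++ rest))
        + (ι (R s x) + count (λ u → R u x) S)
    ≡⟨ regroup (ι (R x s)) _ (count (R s) (S ++ rest)) _ (ι (R s x)) _ ⟩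
      (ι (R x s) + count (R s) (S ++ rest) + ι (R s x))
        + (forward R (x ∷ S ++ rest) + count (λ u → R u x) S)
    ≡⟨ cong ((ι (R x s) + count (R s) (S ++ rest) + ι (R s x)) +_) (forward-moveˡ R x S rest) ⟩
      (ι (R x s) + count (R s) (S ++ rest) + ι (R s x)) + (forward R (S ++ x ∷ rest) + count (R x) S)
    ≡⟨ regroup′ (ι (R x s)) (count (R s) (S ++ rest)) (ι (R s x)) _ _ ⟩
      (ι (R s x) + count (R s) (S ++ rest) + forward R (S ++ x ∷ rest)) + (ι (R x s) + count (R x) S)
    ≡⟨ cong (λ k → k + forward R (S ++ x ∷ rest) + (ι (R x s) + count (R x) S))
            (count-↭ (R s) (shift x S rest)) ⟨
      (count (R s) (S ++ x ∷ rest) + forward R (S ++ x ∷ rest)) + (ι (R x s) + count (R x) S)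
    ∎
    where
    open ≡-Reasoning
    regroup : ∀ a b c f e g → (a + b) + (c + f) + (e + g) ≡ (a + c + e) + ((b + f) + g)
    regroup = solve-∀
    regroup′ : ∀ a c e f g → (a + c + e) + (f + g) ≡ (e + c + f) + (a + g)
    regroup′ = solve-∀

  forward-move : ∀ R x pre S rest →
    forward R (pre ++ x ∷ S ++ rest) + count (λ u → R u x) S
      ≡ forward R (pre ++ S ++ x ∷ rest) + count (R x) S
  forward-move R x [] S rest = forward-moveˡ R x S rest
  forward-move R x (u ∷ pre) S rest = begin
      (count (R u) (pre ++ x ∷ S ++ rest) + forward R (pre ++ x ∷ S ++ rest)) + count (λ v → R v x) S
    ≡⟨ +-assoc (count (R u) (pre ++ x ∷ S ++ rest)) _ _ ⟩
      count (R u) (pre ++ x ∷ S ++ rest) + (forward R (pre ++ x ∷ S ++ rest) + count (λ v → R v x) S)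
    ≡⟨ cong₂ _+_ (count-↭ (R u) (++⁺ˡ pre (↭-sym (shift x S rest)))) (forward-move R x pre S rest) ⟩
      count (R u) (pre ++ S ++ x ∷ rest) + (forward R (pre ++ S ++ x ∷ rest) + count (R x) S)
    ≡⟨ +-assoc (count (R u) (pre ++ S ++ x ∷ rest)) _ _ ⟨
      (count (R u) (pre ++ S ++ x ∷ rest) + forward R (pre ++ S ++ x ∷ rest)) + count (R x) S
    ∎
    where open ≡-Reasoning

anyFin-intro : ∀ {N} (p : Fin N → Bool) i → p i ≡ true → anyFin p ≡ true
anyFin-intro p zero h rewrite h = refl
anyFin-intro p (suc i) h with p zero
... | true = refl
... | false = anyFin-intro (λ j → p (suc j)) i h

anyFin-elim : ∀ {N} (p : Fin N → Bool) → anyFin p ≡ true → ∃ λ i → p i ≡ true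
anyFin-elim {suc N} p h with p zero in eq
... | true = zero , eq
... | false with i , e ← anyFin-elim (λ j → p (suc j)) h = suc i , e

count-allFin : ∀ {N} (p : Fin N → Bool) → count p (allFin N) ≡ countFin p
count-allFin p = count-tabulate p (λ i → i)
  where
  count-tabulate : ∀ {N} {A : Set} (p : A → Bool) (f : Fin N → A) →
                   count p (tabulate f) ≡ countFin (λ i → p (f i))
  count-tabulate {zero} p f = refl
  count-tabulate {suc N} p f = cong (ι (p (f zero)) +_) (count-tabulate p (λ i → f (suc i)))

countFin-false : ∀ {N} (p : Fin N → Bool) → (∀ i → p i ≡ false) → countFin p ≡ 0
countFin-false {zero} p h = refl
countFin-false {suc N} p h rewrite h zero = countFin-false (λ i → p (suc i)) (λ i → h (suc i))

countFin≤1 : ∀ {N} (p : Fin N → Bool) → (∀ i j → p i ≡ true → p j ≡ true → i ≡ j) →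
             countFin p ≤ 1
countFin≤1 {zero} p h = z≤n
countFin≤1 {suc N} p h with p zero in eq
... | true = ≤-reflexive (cong suc (countFin-false (λ i → p (suc i)) rest-false))
  where
  rest-false : ∀ i → p (suc i) ≡ false
  rest-false i with p (suc i) in e
  ... | false = refl
  ... | true with () ← h zero (suc i) eq e
... | false = countFin≤1 (λ i → p (suc i)) (λ i j pi pj → Fin.suc-injective (h (suc i) (suc j) pi pj))

-- InY j ℓ reduces only once it is known whether j is 1 (as Y₁ is X₁), hence the splits on j.
¬InY-A : ∀ j i → ¬ InY j (A i)
¬InY-A zero i ()
¬InY-A (suc zero) i ()
¬InY-A (suc (suc k)) i ()

¬InY-M : ∀ j i → ¬ InY j (M i)
¬InY-M zero i ()
¬InY-M (suc zero) i ()
¬InY-M (suc (suc k)) i ()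

InY-Y : ∀ j → InY j (Y j)
InY-Y zero = refl
InY-Y (suc zero) = refl
InY-Y (suc (suc k)) = refl

InY-Y⇒≡ : ∀ k j → InY k (Y j) → k ≡ j
InY-Y⇒≡ zero j e = e
InY-Y⇒≡ (suc zero) j e = e
InY-Y⇒≡ (suc (suc k)) j e = e

InY-X⇒≡1 : ∀ k j → InY k (X j) → j ≡ 1
InY-X⇒≡1 (suc zero) j e = sym e

InX∧InY⇒≡1 : ∀ {j k} ℓ → InX j ℓ → InY k ℓ → j ≡ 1
InX∧InY⇒≡1 (X j) refl y = InY-X⇒≡1 _ j y

InY-unique : ∀ {i i'} ℓ → InY i ℓ → InY i' ℓ → i ≡ i'
InY-unique {i} (A k) p q = ⊥-elim (¬InY-A i k p)
InY-unique {i} (M k) p q = ⊥-elim (¬InY-M i k p)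
InY-unique {i} {i'} (X k) p q = trans (InY-X⇒i≡1 i p) (sym (InY-X⇒i≡1 i' q))
  where
  InY-X⇒i≡1 : ∀ i → InY i (X k) → i ≡ 1
  InY-X⇒i≡1 (suc zero) _ = refl
InY-unique {i} {i'} (Y k) p q = trans (InY-Y⇒≡ i k p) (sym (InY-Y⇒≡ i' k q))

InM-unique : ∀ {i i'} ℓ → InM i ℓ → InM i' ℓ → i ≡ i'
InM-unique (M k) refl refl = refl

InM⇒¬InY : ∀ {i j} ℓ → InM i ℓ → ¬ InY j ℓ
InM⇒¬InY {j = j} (M k) _ = ¬InY-M j k

InAM⊎InXY : ∀ ℓ → InAM ℓ ⊎ InXY ℓ
InAM⊎InXY (A i) = inj₁ (inj₁ (i , refl))
InAM⊎InXY (M i) = inj₁ (inj₂ (i , refl))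
InAM⊎InXY (X i) = inj₂ (inj₁ (i , refl))
InAM⊎InXY (Y i) = inj₂ (inj₂ (i , InY-Y i))

InAM⇒¬InXY : ∀ ℓ → InAM ℓ → ¬ InXY ℓ
InAM⇒¬InXY (A i) _ (inj₁ (_ , ()))
InAM⇒¬InXY (A i) _ (inj₂ (j , y)) = ¬InY-A j i y
InAM⇒¬InXY (M i) _ (inj₁ (_ , ()))
InAM⇒¬InXY (M i) _ (inj₂ (j , y)) = ¬InY-M j i y
InAM⇒¬InXY (X i) (inj₁ (_ , ()))
InAM⇒¬InXY (X i) (inj₂ (_ , ()))
InAM⇒¬InXY (Y i) (inj₁ (_ , ()))
InAM⇒¬InXY (Y i) (inj₂ (_ , ()))

InXY-split : ∀ ℓ → InXY ℓ → InAny InY ℓ ⊎ (∃ λ j → InX j ℓ × j ≢ 1)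
InXY-split (X j) _ with j ≟ 1
... | yes refl = inj₁ (1 , refl)
... | no j≢1 = inj₂ (j , refl , j≢1)
InXY-split (Y j) _ = inj₁ (j , InY-Y j)
InXY-split (A i) s = ⊥-elim (InAM⇒¬InXY (A i) (inj₁ (i , refl)) s)
InXY-split (M i) s = ⊥-elim (InAM⇒¬InXY (M i) (inj₂ (i , refl)) s)

module _ {n l : ℕ} where

  valid-A : ∀ {i} ℓ → InA i ℓ → ValidLabel n l ℓ → i ≤ n
  valid-A (A i) refl v = v

  valid-M : ∀ {i} ℓ → InM i ℓ → ValidLabel n l ℓ → 1 ≤ i × i ≤ l
  valid-M (M i) refl v = v

  valid-X : ∀ {j} ℓ → InX j ℓ → ValidLabel n l ℓ → 1 ≤ j
  valid-X (X j) refl v = proj₁ v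

EdgeReason± : ℕ → Label → Label → Set
EdgeReason± l a b = EdgeReason l a b ⊎ EdgeReason l b a

edge-AX : ∀ {l i j} ℓ ℓ' → InA i ℓ → InX j ℓ' → EdgeReason± l ℓ ℓ' → j ≡ 1 ⊎ j ≤ i
edge-AX (A i) (X j) refl refl (inj₁ (inj₁ (s , _))) = ⊥-elim (InAM⇒¬InXY (A i) (inj₁ (i , refl)) s)
edge-AX (A i) (X j) refl refl (inj₁ (inj₂ (inj₁ (_ , _ , _ , j≤i , refl , refl)))) = inj₂ j≤i
edge-AX (A i) (X j) refl refl (inj₁ (inj₂ (inj₂ (inj₁ (_ , k , y))))) = inj₁ (InY-X⇒≡1 k j y)
edge-AX (A i) (X j) refl refl (inj₁ (inj₂ (inj₂ (inj₂ (inj₁ (_ , _ , _ , () , _))))))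
edge-AX (A i) (X j) refl refl (inj₁ (inj₂ (inj₂ (inj₂ (inj₂ (_ , _ , _ , _ , () , _))))))
edge-AX (A i) (X j) refl refl (inj₂ (inj₁ (_ , s))) = ⊥-elim (InAM⇒¬InXY (A i) (inj₁ (i , refl)) s)
edge-AX (A i) (X j) refl refl (inj₂ (inj₂ (inj₁ (_ , _ , _ , _ , () , _))))
edge-AX (A i) (X j) refl refl (inj₂ (inj₂ (inj₂ (inj₁ ((_ , ()) , _)))))
edge-AX (A i) (X j) refl refl (inj₂ (inj₂ (inj₂ (inj₂ (inj₁ (_ , _ , _ , () , _))))))
edge-AX (A i) (X j) refl refl (inj₂ (inj₂ (inj₂ (inj₂ (inj₂ (_ , _ , _ , _ , () , _))))))

edge-MY : ∀ {l i} ℓ ℓ' → InM i ℓ → InXY ℓ' → EdgeReason± l ℓ ℓ' →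
          ∃ λ j → InY j ℓ' × i ≤ j × j ≤ l + 1
edge-MY (M i) ℓ' refl s (inj₁ (inj₁ (s′ , _))) = ⊥-elim (InAM⇒¬InXY (M i) (inj₂ (i , refl)) s′)
edge-MY (M i) ℓ' refl s (inj₁ (inj₂ (inj₁ (_ , _ , _ , _ , () , _))))
edge-MY (M i) ℓ' refl s (inj₁ (inj₂ (inj₂ (inj₁ ((_ , ()) , _)))))
edge-MY {l} (M i) ℓ' refl s (inj₁ (inj₂ (inj₂ (inj₂ (inj₁ (_ , _ , i≤l , refl , y)))))) =
  i , y , ≤-refl , ≤-trans i≤l (m≤m+n l 1)
edge-MY (M i) ℓ' refl s (inj₁ (inj₂ (inj₂ (inj₂ (inj₂ (_ , j , i<j , j≤ , refl , y)))))) =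
  j , y , <⇒≤ i<j , j≤
edge-MY (M i) ℓ' refl s (inj₂ (inj₁ (_ , s′))) = ⊥-elim (InAM⇒¬InXY (M i) (inj₂ (i , refl)) s′)
edge-MY (M i) ℓ' refl s (inj₂ (inj₂ (inj₁ (_ , _ , _ , _ , _ , ()))))
edge-MY (M i) ℓ' refl s (inj₂ (inj₂ (inj₂ (inj₁ (_ , j , y))))) = ⊥-elim (¬InY-M j i y)
edge-MY (M i) ℓ' refl s (inj₂ (inj₂ (inj₂ (inj₂ (inj₁ (_ , _ , _ , _ , y)))))) =
  ⊥-elim (¬InY-M _ i y)
edge-MY (M i) ℓ' refl s (inj₂ (inj₂ (inj₂ (inj₂ (inj₂ (_ , _ , _ , _ , _ , y)))))) =
  ⊥-elim (¬InY-M _ i y)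

module GeneralizedCombStructure {N : ℕ} {G : SubGraph N} (comb : IsGeneralizedComb G)
  (Adj-sym : ∀ {u v} → SubGraph.Adj G u v → SubGraph.Adj G v u)
  (Adj⇒Vtx : ∀ {u v} → SubGraph.Adj G u v → SubGraph.Vtx G u) where

  open SubGraph G
  open IsGeneralizedComb comb

  Adj⇒Vtxʳ : ∀ {u v} → Adj u v → Vtx v
  Adj⇒Vtxʳ uv = Adj⇒Vtx (Adj-sym uv)

  nonadjacent-A-XY : ∀ {a s i} → Vtx a → Vtx s → InA i (lab a) → InXY (lab s) → ¬ Adj a s →
                     ∃ λ j → InX j (lab s) × i < j × j ≢ 1
  nonadjacent-A-XY {a} {s} {i} va vs aA sXY ¬as with InXY-split (lab s) sXY
  ... | inj₁ sY = ⊥-elim (¬as (compAY a s va vs (i , aA) sY))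
  ... | inj₂ (j , sX , j≢1) with j ≤? i
  ...   | no j≰i = j , sX , ≰⇒> j≰i , j≢1
  ...   | yes j≤i = ⊥-elim (¬as (compAX i j a s va vs (valid-X (lab s) sX (valid s vs)) j≤i
                                         (valid-A (lab a) aA (valid a va)) aA sX))

  adjacent-A-X : ∀ {a s i j} → Vtx a → Vtx s → InA i (lab a) → InX j (lab s) → Adj a s →
                 j ≡ 1 ⊎ j ≤ i
  adjacent-A-X {a} {s} va vs aA sX as = edge-AX (lab a) (lab s) aA sX (noOther a s va vs as)

  adjacent-M-XY : ∀ {a s i} → Vtx a → Vtx s → InM i (lab a) → InXY (lab s) → Adj a s →
                  ∃ λ j → InY j (lab s) × i ≤ j × j ≤ l + 1
  adjacent-M-XY {a} {s} va vs aM sXY as = edge-MY (lab a) (lab s) aM sXY (noOther a s va vs as)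

  nonadjacent-M-Y : ∀ {a s i j} → Vtx a → Vtx s → InM i (lab a) → InY j (lab s) → j ≤ l + 1 →
                    ¬ Adj a s → j ≤ i
  nonadjacent-M-Y {a} {s} {i} {j} va vs aM sY j≤ ¬as with j ≤? i
  ... | yes j≤i = j≤i
  ... | no j≰i =
    ⊥-elim (¬as (compMY i j a s va vs (proj₁ (valid-M (lab a) aM (valid a va))) (≰⇒> j≰i) j≤ aM sY))

  record Induced2K2 (a b w v : Fin N) : Set where
    field
      ab : Adj a b
      wv : Adj w v
      ¬av : ¬ Adj a v
      ¬wb : ¬ Adj w b
      a≢v : a ≢ v
      w≢b : w ≢ b

    va : Vtx a
    va = Adj⇒Vtx ab
    vb : Vtx b
    vb = Adj⇒Vtxʳ ab
    vw : Vtx w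
    vw = Adj⇒Vtx wv
    vv : Vtx v
    vv = Adj⇒Vtxʳ wv

  open Induced2K2

  Induced2K2-flip : ∀ {a b w v} → Induced2K2 a b w v → Induced2K2 w v a b
  Induced2K2-flip K = record
    { ab = wv K ; wv = ab K ; ¬av = ¬wb K ; ¬wb = ¬av K ; a≢v = w≢b K ; w≢b = a≢v K }

  Induced2K2-reverse : ∀ {a b w v} → Induced2K2 a b w v → Induced2K2 b a v w
  Induced2K2-reverse K = record
    { ab = Adj-sym (ab K) ; wv = Adj-sym (wv K)
    ; ¬av = λ b~w → ¬wb K (Adj-sym b~w) ; ¬wb = λ v~a → ¬av K (Adj-sym v~a)
    ; a≢v = λ b≡w → w≢b K (sym b≡w) ; w≢b = λ v≡a → a≢v K (sym v≡a) }

  -- A_i is joined to X_1, …, X_i, so the X-neighbourhoods of two A-vertices are nested.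
  induced2K2-A-absurd : ∀ {a b w v i} → Induced2K2 a b w v → InA i (lab a) → InAM (lab w) →
                        InXY (lab b) → InXY (lab v) → ⊥
  induced2K2-A-absurd {a} {b} {w} {v} {i} K aA wAM bXY vXY =
    go (nonadjacent-A-XY (va K) (vv K) aA vXY (¬av K)) wAM
    where
    go : (∃ λ j → InX j (lab v) × i < j × j ≢ 1) → InAM (lab w) → ⊥
    go (j , vX , _ , j≢1) (inj₂ (_ , wM))
      with _ , vY , _ ← adjacent-M-XY (vw K) (vv K) wM vXY (wv K) = j≢1 (InX∧InY⇒≡1 (lab v) vX vY)
    go (j , vX , i<j , j≢1) (inj₁ (i' , wA))
      with adjacent-A-X (vw K) (vv K) wA vX (wv K) | nonadjacent-A-XY (vw K) (vb K) wA bXY (¬wb K)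
    ... | inj₁ j≡1 | _ = j≢1 j≡1
    ... | inj₂ j≤i' | j' , bX , i'<j' , j'≢1 with adjacent-A-X (va K) (vb K) aA bX (ab K)
    ...   | inj₁ j'≡1 = j'≢1 j'≡1
    ...   | inj₂ j'≤i =
      <-irrefl refl (<-≤-trans i'<j' (≤-trans j'≤i (≤-trans (<⇒≤ i<j) j≤i')))

  induced2K2-M-Y : ∀ {a b w v} → Induced2K2 a b w v → InAM (lab a) → InAM (lab w) →
                   InXY (lab b) → InXY (lab v) → ∃ λ i → InM i (lab a) × InY i (lab b)
  induced2K2-M-Y K (inj₁ (_ , aA)) wAM bXY vXY = ⊥-elim (induced2K2-A-absurd K aA wAM bXY vXY)
  induced2K2-M-Y K aAM@(inj₂ _) (inj₁ (_ , wA)) bXY vXY =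
    ⊥-elim (induced2K2-A-absurd (Induced2K2-flip K) wA aAM vXY bXY)
  induced2K2-M-Y {b = b} K (inj₂ (i , aM)) (inj₂ (i' , wM)) bXY vXY
    with jb , bY , i≤jb , jb≤ ← adjacent-M-XY (va K) (vb K) aM bXY (ab K)
       | jv , vY , i'≤jv , jv≤ ← adjacent-M-XY (vw K) (vv K) wM vXY (wv K) =
    i , aM , subst (λ k → InY k (lab b)) jb≡i bY
    where
    jv≤i = nonadjacent-M-Y (va K) (vv K) aM vY jv≤ (¬av K)
    jb≤i' = nonadjacent-M-Y (vw K) (vb K) wM bY jb≤ (¬wb K)
    jb≡i : jb ≡ i
    jb≡i = ≤-antisym (≤-trans jb≤i' (≤-trans i'≤jv jv≤i)) i≤jb

  MatchingEdge : Fin N → Fin N → Set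
  MatchingEdge a b =
    (∃ λ i → InM i (lab a) × InY i (lab b)) ⊎ (∃ λ i → InY i (lab a) × InM i (lab b))

  induced2K2⇒matchingEdge : ∀ {a b w v} → Induced2K2 a b w v → MatchingEdge a b
  induced2K2⇒matchingEdge {a} {b} {w} {v} K =
    go (InAM⊎InXY (lab a)) (InAM⊎InXY (lab b)) (InAM⊎InXY (lab w)) (InAM⊎InXY (lab v))
    where
    go : InAM (lab a) ⊎ InXY (lab a) → InAM (lab b) ⊎ InXY (lab b) →
         InAM (lab w) ⊎ InXY (lab w) → InAM (lab v) ⊎ InXY (lab v) → MatchingEdge a b
    go (inj₁ aAM) (inj₁ bAM) _ _ = ⊥-elim (stableAM a b (va K) (vb K) aAM bAM (ab K))
    go _ _ (inj₁ wAM) (inj₁ vAM) = ⊥-elim (stableAM w v (vw K) (vv K) wAM vAM (wv K))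
    go _ (inj₂ bXY) (inj₂ wXY) _ = ⊥-elim (¬wb K (cliqueXY w b (vw K) (vb K) (w≢b K) wXY bXY))
    go (inj₂ aXY) _ _ (inj₂ vXY) = ⊥-elim (¬av K (cliqueXY a v (va K) (vv K) (a≢v K) aXY vXY))
    go (inj₁ aAM) (inj₂ bXY) (inj₁ wAM) (inj₂ vXY) = inj₁ (induced2K2-M-Y K aAM wAM bXY vXY)
    go (inj₂ aXY) (inj₁ bAM) (inj₂ wXY) (inj₁ vAM)
      with i , bM , aY ← induced2K2-M-Y (Induced2K2-reverse K) bAM vAM aXY wXY = inj₂ (i , aY , bM)

  matchingEdge-unique : ∀ {a a' b} → Adj a b → Adj a' b → MatchingEdge a b → MatchingEdge a' b →
                        a ≡ a'
  matchingEdge-unique {a} {a'} {b} ab a'b (inj₁ (i , aM , bY)) (inj₁ (_ , a'M , bY'))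
    with 1≤i , i≤l ← valid-M (lab a) aM (valid a (Adj⇒Vtx ab))
    with _ , _ , partner-unique ← proj₂ (matchM i 1≤i i≤l (a , Adj⇒Vtx ab , aM)) b (Adj⇒Vtxʳ ab) bY =
    trans (partner-unique a (Adj⇒Vtx ab) aM (Adj-sym ab))
          (sym (partner-unique a' (Adj⇒Vtx a'b) a'Mᵢ (Adj-sym a'b)))
    where a'Mᵢ = subst (λ k → InM k (lab a')) (InY-unique (lab b) bY' bY) a'M
  matchingEdge-unique {a} {a'} {b} ab a'b (inj₂ (i , aY , bM)) (inj₂ (_ , a'Y , bM'))
    with 1≤i , i≤l ← valid-M (lab b) bM (valid b (Adj⇒Vtxʳ ab))
    with _ , _ , partner-unique ← proj₁ (matchM i 1≤i i≤l (b , Adj⇒Vtxʳ ab , bM)) b (Adj⇒Vtxʳ ab) bM =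
    trans (partner-unique a (Adj⇒Vtx ab) aY (Adj-sym ab))
          (sym (partner-unique a' (Adj⇒Vtx a'b) a'Yᵢ (Adj-sym a'b)))
    where a'Yᵢ = subst (λ k → InY k (lab a')) (InM-unique (lab b) bM' bM) a'Y
  matchingEdge-unique {b = b} _ _ (inj₁ (_ , _ , bY)) (inj₂ (_ , _ , bM)) =
    ⊥-elim (InM⇒¬InY (lab b) bM bY)
  matchingEdge-unique {b = b} _ _ (inj₂ (_ , _ , bM)) (inj₁ (_ , _ , bY)) =
    ⊥-elim (InM⇒¬InY (lab b) bM bY)

module Beating {N : ℕ} (D : Digraph N) where

  twoPath : Fin N → Fin N → Bool
  twoPath v b = anyFin (λ c → D v c ∧ D c b)

  escapes : Fin N → Fin N → Fin N → Bool
  escapes a b v = D v a ∧ (not (D v b) ∧ not (twoPath v b))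

  beats : Fin N → Fin N → Bool
  beats a b = D a b ∨ (not (D b a) ∧ not (anyFin (escapes a b)))

  arc⇒beats : ∀ {a b} → D a b ≡ true → beats a b ≡ true
  arc⇒beats a→b rewrite a→b = refl

  beats-twoPath : ∀ {a b v} → beats a b ≡ true → D v a ≡ true → D v b ≡ false →
                  twoPath v b ≡ true
  beats-twoPath {a} {b} {v} a⊳b v→a v↛b with D a b in a→b
  ... | true = anyFin-intro (λ c → D v c ∧ D c b) a (∧-intro v→a a→b)
  ... | false with escapes a b v in v-escapes
  ...   | true = ⊥-elim (true≢false (proj₂ (∧-elim {not (D b a)} a⊳b))
                                  (cong not (anyFin-intro (escapes a b) v v-escapes)))
  ...   | false rewrite v→a | v↛b = not-false v-escapes

  unbeaten⇒escaping : ∀ {a b} → beats a b ≡ false → D b a ≡ false →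
                      ∃ λ v → D v a ≡ true × D v b ≡ false × twoPath v b ≡ false
  unbeaten⇒escaping {a} {b} a⋫b b↛a with D a b | D b a
  ... | false | false with v , v-escapes ← anyFin-elim (escapes a b) (not-false a⋫b)
    with v→a , r ← ∧-elim v-escapes
    with v↛b , v↛↛b ← ∧-elim r = v , v→a , not-true v↛b , not-true v↛↛b

  record Obstruction (x b : Fin N) : Set where
    field
      x↛b : D x b ≡ false
      b↛x : D b x ≡ false
      v : Fin N
      v→x : D v x ≡ true
      v↛b : D v b ≡ false
      v↛↛b : twoPath v b ≡ false
      w : Fin N
      w→b : D w b ≡ true
      w↛x : D w x ≡ false
      w↛↛x : twoPath w x ≡ false

  unbeaten⇒obstruction : ∀ {x b} → beats x b ≡ false → beats b x ≡ false → Obstruction x b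
  unbeaten⇒obstruction x⋫b b⋫x
    with x↛b , _ ← ∨-elim-false x⋫b | b↛x , _ ← ∨-elim-false b⋫x
    with v , v→x , v↛b , v↛↛b ← unbeaten⇒escaping x⋫b b↛x
       | w , w→b , w↛x , w↛↛x ← unbeaten⇒escaping b⋫x x↛b =
    record { x↛b = x↛b ; b↛x = b↛x ; v = v ; v→x = v→x ; v↛b = v↛b ; v↛↛b = v↛↛b
           ; w = w ; w→b = w→b ; w↛x = w↛x ; w↛↛x = w↛↛x }

module Obstructions {N : ℕ} (D : Digraph N) (oriented : IsOriented D)
                    (comb : MissingGeneralizedComb D) where
  open Beating D

  no-loop : ∀ v → D v v ≡ false
  no-loop v = ¬-not (proj₁ oriented v)

  arc⇒¬arcBack : ∀ {u v} → D u v ≡ true → D v u ≡ false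
  arc⇒¬arcBack {u} {v} u→v = ¬-not (proj₂ oriented u v u→v)

  arc⇒¬beatsBack : ∀ {a b} → D b a ≡ true → beats a b ≡ false
  arc⇒¬beatsBack {a} {b} b→a rewrite arc⇒¬arcBack b→a | b→a = refl

  missing-sym : ∀ {u v} → Missing D u v → Missing D v u
  missing-sym (u≢v , u↛v , v↛u) = (λ v≡u → u≢v (sym v≡u)) , v↛u , u↛v

  missing⇒vertex : ∀ {u v} → Missing D u v → SubGraph.Vtx (missingGraph D) u
  missing⇒vertex {v = v} m = v , missing-sym m

  open GeneralizedCombStructure comb missing-sym missing⇒vertex

  obstruction⇒induced2K2 : ∀ {x b} (o : Obstruction x b) →
                           Induced2K2 x b (Obstruction.w o) (Obstruction.v o)
  obstruction⇒induced2K2 {x} {b} o = record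
    { ab = x≢b , x↛b , b↛x ; wv = w≢v , w↛v , v↛w
    ; ¬av = λ (_ , _ , v↛x) → true≢false v→x v↛x
    ; ¬wb = λ (_ , w↛b , _) → true≢false w→b w↛b
    ; a≢v = λ { refl → true≢false v→x (no-loop x) }
    ; w≢b = λ { refl → true≢false w→b (no-loop w) } }
    where
    open Obstruction o
    x≢b : x ≢ b
    x≢b refl = true≢false v→x v↛b
    w≢v : w ≢ v
    w≢v refl = true≢false v→x w↛x
    w↛v : D w v ≡ false
    w↛v = ¬-not λ w→v →
      true≢false (anyFin-intro (λ c → D w c ∧ D c x) v (∧-intro w→v v→x)) w↛↛x
    v↛w : D v w ≡ false
    v↛w = ¬-not λ v→w →
      true≢false (anyFin-intro (λ c → D v c ∧ D c b) w (∧-intro v→w w→b)) v↛↛b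

  obstruction-unique : ∀ {x x' b} → Obstruction x b → Obstruction x' b → x ≡ x'
  obstruction-unique o o' =
    matchingEdge-unique (ab K) (ab K') (induced2K2⇒matchingEdge K) (induced2K2⇒matchingEdge K')
    where
    K = obstruction⇒induced2K2 o
    K' = obstruction⇒induced2K2 o'
    open Induced2K2

module MedianOrder {N : ℕ} (D : Digraph (suc N)) (oriented : IsOriented D)
                   (comb : MissingGeneralizedComb D) where
  open Beating D
  open Obstructions D oriented comb

  V : Set
  V = Fin (suc N)

  WithinTwo : V → V → Set
  WithinTwo d u = D d u ≡ true ⊎ inN⁺⁺ D d u ≡ true

  Beyond : V → V → Set
  Beyond d u = D d u ≡ false × inN⁺⁺ D d u ≡ false

  withinTwo? : ∀ d u → WithinTwo d u ⊎ Beyond d u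
  withinTwo? d u = decide (D d u) (inN⁺⁺ D d u) refl refl
    where
    decide : ∀ a b → D d u ≡ a → inN⁺⁺ D d u ≡ b → WithinTwo d u ⊎ Beyond d u
    decide true _ d→u _ = inj₁ (inj₁ d→u)
    decide false true _ u∈N⁺⁺ = inj₁ (inj₂ u∈N⁺⁺)
    decide false false d↛u u∉N⁺⁺ = inj₂ (d↛u , u∉N⁺⁺)

  Satisfied : V → List V → Set
  Satisfied d xs = count (D d) xs ≤ count (inN⁺⁺ D d) xs

  IsOrder : List V → V → Set
  IsOrder xs d = xs ∷ʳ d ↭ allFin (suc N)

  outAfter : V → V → V → Bool
  outAfter d u v = not (D d u) ∧ D d v

  K : ℕ
  K = suc (suc N * suc N)

  -- Lexicographic, since the second summand stays below K (outAfter-bound).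
  potential : List V → V → ℕ
  potential xs d = K * forward beats (xs ∷ʳ d) + forward (outAfter d) xs

  bound : ℕ
  bound = K * (suc N * suc N) + suc N * suc N

  Better : List V → V → Set
  Better xs d = Σ (List V) λ xs' → Σ V λ d' → IsOrder xs' d' × potential xs d < potential xs' d'

  order-length : ∀ {xs d} → IsOrder xs d → length (xs ∷ʳ d) ≡ suc N
  order-length π = trans (↭-length π) (length-tabulate (λ i → i))

  count-order : ∀ {xs d} p → IsOrder xs d → count p (xs ∷ʳ d) ≡ countFin p
  count-order p π = trans (count-↭ p π) (count-allFin p)

  outAfter-bound : ∀ {xs d} → IsOrder xs d → forward (outAfter d) xs < K
  outAfter-bound {xs} {d} π =
    s≤s (≤-trans (forward≤length² (outAfter d) xs) (*-mono-≤ length≤ length≤))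
    where
    length≤ : length xs ≤ suc N
    length≤ = ≤-trans (m≤m+n (length xs) 1) (≤-reflexive (trans (sym (length-++ xs)) (order-length π)))

  potential≤bound : ∀ {xs d} → IsOrder xs d → potential xs d ≤ bound
  potential≤bound {xs} {d} π =
    +-mono-≤ (*-monoʳ-≤ K (≤-trans (forward≤length² beats (xs ∷ʳ d))
                                   (≤-reflexive (cong (λ k → k * k) (order-length π)))))
             (≤-pred (outAfter-bound π))

  satisfied-++ : ∀ {d} xs ys → Satisfied d xs → Satisfied d ys → Satisfied d (xs ++ ys)
  satisfied-++ {d} xs ys sx sy =
    subst₂ _≤_ (sym (count-++ (D d) xs ys)) (sym (count-++ (inN⁺⁺ D d) xs ys)) (+-mono-≤ sx sy)

  satisfied-non-out : ∀ {d x} → D d x ≡ false → Satisfied d [ x ]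
  satisfied-non-out d↛x rewrite d↛x = z≤n

  satisfied⇒conjecture : ∀ {xs d} → IsOrder xs d → Satisfied d xs → outdeg D d ≤ secondOutdeg D d
  satisfied⇒conjecture {xs} {d} π sat = begin
    countFin (D d)                                  ≡⟨ count-order (D d) π ⟨
    count (D d) (xs ∷ʳ d)                           ≡⟨ count-++ (D d) xs [ d ] ⟩
    count (D d) xs + count (D d) [ d ]              ≤⟨ +-mono-≤ sat (≤-reflexive no-self-count) ⟩
    count (inN⁺⁺ D d) xs + 0                        ≤⟨ +-monoʳ-≤ _ z≤n ⟩
    count (inN⁺⁺ D d) xs + count (inN⁺⁺ D d) [ d ]  ≡⟨ count-++ (inN⁺⁺ D d) xs [ d ] ⟨
    count (inN⁺⁺ D d) (xs ∷ʳ d)                     ≡⟨ count-order (inN⁺⁺ D d) π ⟩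
    countFin (inN⁺⁺ D d)                            ∎
    where
    open ≤-Reasoning
    no-self-count : count (D d) [ d ] ≡ 0
    no-self-count rewrite no-loop d = refl

  tied : V → V → V → Bool
  tied d x u = D d u ∧ (not (beats u x) ∧ not (beats x u))

  tied-unique : ∀ {d x u u'} → tied d x u ≡ true → tied d x u' ≡ true → u ≡ u'
  tied-unique {d} {x} {u} {u'} t t'
    with _ , r ← ∧-elim {D d u} t | _ , r' ← ∧-elim {D d u'} t'
    with u⋫x , x⋫u ← ∧-elim {not (beats u x)} r | u'⋫x , x⋫u' ← ∧-elim {not (beats u' x)} r' =
    obstruction-unique (unbeaten⇒obstruction (not-true u⋫x) (not-true x⋫u))
                       (unbeaten⇒obstruction (not-true u'⋫x) (not-true x⋫u'))

  count-tied≤1 : ∀ {d x e} pre S rest → IsOrder (pre ++ S ++ rest) e → count (tied d x) S ≤ 1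
  count-tied≤1 {d} {x} {e} pre S rest π = begin
    count (tied d x) S                          ≤⟨ count-infix (tied d x) pre S rest ⟩
    count (tied d x) (pre ++ S ++ rest)         ≤⟨ count-infix (tied d x) [] (pre ++ S ++ rest) [ e ] ⟩
    count (tied d x) ((pre ++ S ++ rest) ∷ʳ e)  ≡⟨ count-order (tied d x) π ⟩
    countFin (tied d x)                         ≤⟨ countFin≤1 (tied d x) (λ _ _ → tied-unique) ⟩
    1                                           ∎
    where open ≤-Reasoning

  out-neighbour-¬beats : ∀ {d u x} → D d u ≡ true → Beyond d x → beats u x ≡ false
  out-neighbour-¬beats {d} {u} {x} d→u (d↛x , x∉N⁺⁺) = ¬-not λ u⊳x →
    true≢false (subst (λ b → not b ∧ twoPath d x ≡ true) (sym d↛x) (beats-twoPath u⊳x d→u d↛x)) x∉N⁺⁺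

  beaten-second : ∀ {d y S} → All (WithinTwo d) S → (∀ {u} → D d u ≡ true → beats u y ≡ false) →
                  count (λ u → beats u y) S ≤ count (inN⁺⁺ D d) S
  beaten-second inS out-¬beats = count-mono (All.map within⇒second inS)
    where
    within⇒second : ∀ {u} → WithinTwo _ u → beats u _ ≡ true → inN⁺⁺ D _ u ≡ true
    within⇒second (inj₁ d→u) u⊳y = ⊥-elim (true≢false u⊳y (out-¬beats d→u))
    within⇒second (inj₂ u∈N⁺⁺) _ = u∈N⁺⁺

  segment-satisfied-feed : ∀ {d} S → All (WithinTwo d) S →
                           count (beats d) S ≤ count (λ u → beats u d) S →
                           Satisfied d S
  segment-satisfied-feed {d} S inS out≤in =
    ≤-trans (count-mono (All.universal (λ _ → arc⇒beats) S))
            (≤-trans out≤in (beaten-second inS arc⇒¬beatsBack))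

  segment-satisfied-before : ∀ {d x} S → All (WithinTwo d) S → Beyond d x →
                             count (beats x) S + count (tied d x) S ≤ count (λ u → beats u x) S →
                             Satisfied d S
  segment-satisfied-before {d} {x} S inS x-beyond out+tied≤in =
    ≤-trans (count-≤-+ out⊎tied S)
            (≤-trans out+tied≤in (beaten-second inS (λ d→u → out-neighbour-¬beats d→u x-beyond)))
    where
    out⊎tied : ∀ u → ι (D d u) ≤ ι (beats x u) + ι (tied d x u)
    out⊎tied u with D d u in d→u
    ... | false = z≤n
    ... | true rewrite out-neighbour-¬beats d→u x-beyond = ι-excluded-middle (beats x u)

  outAfter-jump : ∀ {d} pre S x rest → D d x ≡ false →
                  forward (outAfter d) (pre ++ x ∷ S ++ rest)
                    ≡ forward (outAfter d) (pre ++ S ++ x ∷ rest) + count (outAfter d x) S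
  outAfter-jump {d} pre S x rest d↛x = begin
    forward (outAfter d) σ'
      ≡⟨ +-identityʳ _ ⟨
    forward (outAfter d) σ' + 0
      ≡⟨ cong (forward (outAfter d) σ' +_) (count-false S nothing-after-x) ⟨
    forward (outAfter d) σ' + count (λ u → outAfter d u x) S
      ≡⟨ forward-move (outAfter d) x pre S rest ⟩
    forward (outAfter d) σ + count (outAfter d x) S
      ∎
    where
    open ≡-Reasoning
    σ = pre ++ S ++ x ∷ rest
    σ' = pre ++ x ∷ S ++ rest
    nothing-after-x : ∀ u → outAfter d u x ≡ false
    nothing-after-x u rewrite d↛x = ∧-zeroʳ (not (D d u))

  tied⇒outAfter : ∀ {d x} → D d x ≡ false → ∀ u → tied d x u ≡ true → outAfter d x u ≡ true
  tied⇒outAfter {d} d↛x u t = subst (λ b → not b ∧ D d u ≡ true) (sym d↛x) (proj₁ (∧-elim {D d u} t))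

  jump-forward : ∀ {d} pre S x rest → IsOrder (pre ++ S ++ x ∷ rest) d → D d x ≡ false →
                 count (λ u → beats u x) S < count (beats x) S + count (tied d x) S →
                 Better (pre ++ S ++ x ∷ rest) d
  jump-forward {d} pre S x rest π d↛x in<out+tied =
    σ' , d , π' ,
    gain (balance-gain (count (tied d x) S) beats-balance in<out+tied (count-tied≤1 pre S (x ∷ rest) π))
    where
    σ = pre ++ S ++ x ∷ rest
    σ' = pre ++ x ∷ S ++ rest
    Q = forward (outAfter d) σ
    Q' = forward (outAfter d) σ'
    fT = forward beats (σ ∷ʳ d)
    fT' = forward beats (σ' ∷ʳ d)

    π' : IsOrder σ' d
    π' = ↭-trans (++⁺ʳ [ d ] (++⁺ˡ pre (↭-sym (shift x S rest)))) π

    beats-balance : fT' + count (λ u → beats u x) S ≡ fT + count (beats x) S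
    beats-balance =
      subst₂ (λ L L' → forward beats L + count (λ u → beats u x) S ≡ forward beats L' + count (beats x) S)
        (sym (trans (++-assoc pre (x ∷ S ++ rest) [ d ]) (cong (λ L → pre ++ x ∷ L) (++-assoc S rest [ d ]))))
        (sym (trans (++-assoc pre (S ++ x ∷ rest) [ d ]) (cong (pre ++_) (++-assoc S (x ∷ rest) [ d ]))))
        (forward-move beats x pre S (rest ∷ʳ d))

    Q<Q' : count (tied d x) S ≡ 1 → Q < Q'
    Q<Q' c≡1 = begin-strict
      Q                               <⟨ m<m+n Q (≤-reflexive (sym c≡1)) ⟩
      Q + count (tied d x) S          ≤⟨ +-monoʳ-≤ Q (count-mono (All.universal (tied⇒outAfter d↛x) S)) ⟩
      Q + count (outAfter d x) S      ≡⟨ outAfter-jump pre S x rest d↛x ⟨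
      Q'                              ∎
      where open ≤-Reasoning

    gain : fT < fT' ⊎ (fT ≡ fT' × count (tied d x) S ≡ 1) → potential σ d < potential σ' d
    gain (inj₁ fT<fT') = lex-< K Q Q' (outAfter-bound π) fT<fT'
    gain (inj₂ (fT≡fT' , c≡1)) =
      subst (λ f → K * fT + Q < K * f + Q') fT≡fT' (+-monoʳ-< (K * fT) (Q<Q' c≡1))

  move-feed : ∀ {d} pre S → IsOrder (pre ++ S) d → count (λ u → beats u d) S < count (beats d) S →
              Better (pre ++ S) d
  move-feed {d} pre S π in<out with initLast S
  ... | [] = ⊥-elim (<-irrefl refl in<out)
  ... | zs ∷ʳ′ z =
    pre ++ d ∷ zs , z , π' , lex-< K _ _ (outAfter-bound π) (balance-< beats-balance in<out)
    where
    feed-inserted : (pre ++ d ∷ zs) ∷ʳ z ≡ pre ++ d ∷ zs ∷ʳ z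
    feed-inserted = ++-assoc pre (d ∷ zs) [ z ]

    π' : IsOrder (pre ++ d ∷ zs) z
    π' = subst (_↭ allFin (suc N)) (sym feed-inserted)
           (↭-trans (++⁺ˡ pre (∷↭∷ʳ d (zs ∷ʳ z)))
                    (subst (_↭ allFin (suc N)) (++-assoc pre (zs ∷ʳ z) [ d ]) π))

    beats-balance : forward beats ((pre ++ d ∷ zs) ∷ʳ z) + count (λ u → beats u d) (zs ∷ʳ z)
                  ≡ forward beats ((pre ++ zs ∷ʳ z) ∷ʳ d) + count (beats d) (zs ∷ʳ z)
    beats-balance =
      subst₂ (λ L L' → forward beats L + count (λ u → beats u d) (zs ∷ʳ z)
                     ≡ forward beats L' + count (beats d) (zs ∷ʳ z))
        (trans (cong (λ L → pre ++ d ∷ L) (++-identityʳ (zs ∷ʳ z))) (sym feed-inserted))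
        (sym (++-assoc pre (zs ∷ʳ z) [ d ]))
        (forward-move beats d pre (zs ∷ʳ z) [])

  module Scan {xs d} (π : IsOrder xs d) where

    Outcome : Set
    Outcome = Satisfied d xs ⊎ Better xs d

    order-at : ∀ {ys} → ys ≡ xs → IsOrder ys d
    order-at eq = subst (λ L → IsOrder L d) (sym eq) π

    improved : ∀ {ys} → ys ≡ xs → Better ys d → Outcome
    improved eq better = inj₂ (subst (λ L → Better L d) eq better)

    finish : ∀ pre S → pre ++ S ≡ xs → All (WithinTwo d) S → Satisfied d pre → Outcome
    finish pre S eq inS sat-pre with count (beats d) S ≤? count (λ u → beats u d) S
    ... | yes out≤in =
      inj₁ (subst (Satisfied d) eq (satisfied-++ pre S sat-pre (segment-satisfied-feed S inS out≤in)))
    ... | no out≰in = improved eq (move-feed pre S (order-at eq) (≰⇒> out≰in))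

    scan : ∀ pre S rest → pre ++ S ++ rest ≡ xs → All (WithinTwo d) S → Satisfied d pre → Outcome
    scan pre S [] eq = finish pre S (trans (cong (pre ++_) (sym (++-identityʳ S))) eq)
    scan pre S (x ∷ rest) eq inS sat-pre with withinTwo? d x
    ... | inj₁ x-within = scan pre (S ∷ʳ x) rest eq′ (∷ʳ⁺ inS x-within) sat-pre
      where eq′ = trans (cong (pre ++_) (++-assoc S [ x ] rest)) eq
    ... | inj₂ x-beyond with count (beats x) S + count (tied d x) S ≤? count (λ u → beats u x) S
    ...   | no out+tied≰in =
      improved eq (jump-forward pre S x rest (order-at eq) (proj₁ x-beyond) (≰⇒> out+tied≰in))
    ...   | yes out+tied≤in = scan (pre ++ S ∷ʳ x) [] rest eq′ [] sat-pre′
      where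
      eq′ = trans (++-assoc pre (S ∷ʳ x) rest) (trans (cong (pre ++_) (++-assoc S [ x ] rest)) eq)
      sat-pre′ = satisfied-++ pre (S ∷ʳ x) sat-pre
                   (satisfied-++ S [ x ] (segment-satisfied-before S inS x-beyond out+tied≤in)
                                         (satisfied-non-out (proj₁ x-beyond)))

  improve : ∀ fuel xs d → IsOrder xs d → bound ∸ potential xs d < fuel →
            ∃ λ v → outdeg D v ≤ secondOutdeg D v
  improve (suc fuel) xs d π slack with Scan.scan π [] [] xs refl [] z≤n
  ... | inj₁ sat = d , satisfied⇒conjecture π sat
  ... | inj₂ (xs' , d' , π' , gain) =
    improve fuel xs' d' π' (<-≤-trans (∸-monoʳ-< gain (potential≤bound π')) (≤-pred slack))

  second-neighbourhood : ∃ λ v → outdeg D v ≤ secondOutdeg D v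
  second-neighbourhood =
    improve (suc bound) (tabulate suc) zero initial-order (s≤s (m∸n≤m bound (potential (tabulate suc) zero)))
    where
    initial-order : IsOrder (tabulate suc) zero
    initial-order = ↭-sym (∷↭∷ʳ zero (tabulate suc))

mainTheorem8 : ∀ {N : ℕ} (D : Digraph (suc N)) → IsOriented D → MissingGeneralizedComb D →
    ∃ λ (v : Fin (suc N)) → outdeg D v ≤ secondOutdeg D v
mainTheorem8 D oriented comb = MedianOrder.second-neighbourhood D oriented comb
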